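{- For any integer $\lambda\ge3$, a $\lambda$-toppler can be emulated by a finite abelian network of adders, splitters and $2$-topplers. So can a delayer.
   Context: $\mathbb{N}=\{0,1,2,\dots\}$. A processor with finite input alphabet $A$, finite output alphabet $B$ and finite state space $Q$ consists of maps $t_i:Q\to Q$, $o_i:Q\to\mathbb{N}^B$ ($i\in A$): on receiving letter $i$ in state $q$ it moves to $t_i(q)$ and emits $(o_i(q))_b$ letters $b$. It is abelian if $t_it_j=t_jt_i$ and $o_i+o_j\circ t_i=o_j+o_i\circ t_j$. It has an initial state and computes $F:\mathbb{N}^A\to\mathbb{N}^B$ giving the total output after receiving $x_a$ letters $a$ for each $a$. An abelian network is a finite directed multigraph with dangling input edges (no tail) and output/trash edges (no head), each node carrying a finite abelian processor with an initial state, whose inputs/outputs are its incoming/outgoing edges. It runs by repeatedly feeding a letter from any non-output non-trash edge into the processor at its head (emitted letters go on the processor's outgoing edges), halting when all letters are on output or trash edges; halting and output are independent of the order. A network that halts on all inputs computes a function; it emulates a processor if it computes the same function. Gates: an adder (one state, two inputs, one output, computes $(x,y)\mapsto x+y$); a splitter (one state, one input, two outputs, computes $x\mapsto(x,x)$); for integer $\lambda\ge2$, a $\lambda$-toppler with one input, one output and states $0,\dots,\lambda-1$: a letter received in state $q<\lambda-1$ moves it to $q+1$ emitting nothing, a letter received in state $\lambda-1$ moves it to $0$ emitting one letter (from state $q$ it computes $x\mapsto\lfloor(x+q)/\lambda\rfloor$); a delayer with states $0,1$, started in state $0$: in state $0$ a received letter moves it to state $1$ emitting nothing, in state $1$ it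 emits one letter per received letter, so it computes $x\mapsto\max(x-1,0)$. -}

module Defs where

open import Data.Nat using (ℕ; zero; suc; _+_; _≤_; _<_; _<?_)
open import Data.Nat.Properties using (+-comm)
open import Data.Fin using (Fin; zero; suc; toℕ; fromℕ<; _≟_)
open import Data.List using (List; []; _∷_; concatMap; replicate; allFin)
open import Data.Sum using (_⊎_; inj₁; inj₂)
open import Data.Product using (Σ; _,_; _×_; ∃; ∃!)
open import Relation.Nullary using (yes; no; ¬_)
open import Relation.Binary.PropositionalEquality using (_≡_; _≢_; refl)
open import Relation.Binary.Construct.Closure.ReflexiveTransitive using (Star)

-- Finite abelian processors with an initial state.
-- Input alphabet Fin ins, output alphabet Fin outs, state space Fin states.
-- o i q b = number of letters b emitted on receiving i in state q.

record Component : Set where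
  field
    ins outs states : ℕ
    t : Fin ins → Fin states → Fin states
    o : Fin ins → Fin states → Fin outs → ℕ
    init : Fin states
    abelian : ∀ i j q → (t i (t j q) ≡ t j (t i q))
                      × (∀ b → o i q b + o j (t i q) b ≡ o j q b + o i (t j q) b)

open Component public

runWord : (P : Component) → Fin (states P) → List (Fin (ins P)) → Fin (outs P) → ℕ
runWord P q [] b = 0
runWord P q (i ∷ w) b = o P i q b + runWord P (t P i q) w b

-- the function F : ℕ^A → ℕ^B computed by the processor from its initial state
-- (inputs fed in a canonical order; order-independent since abelian)
procFun : (P : Component) → (Fin (ins P) → ℕ) → Fin (outs P) → ℕ
procFun P x = runWord P (init P) (concatMap (λ a → replicate (x a) a) (allFin (ins P)))

toppT : ∀ {l} → Fin l → Fin l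
toppT {zero} ()
toppT {suc k} q with suc (toℕ q) <? suc k
... | yes p = fromℕ< p
... | no _  = zero

toppO : ∀ {l} → Fin l → ℕ
toppO {l} q with suc (toℕ q) <? l
... | yes _ = 0
... | no _  = 1

toppler : (l : ℕ) → Fin l → Component
toppler l q = record
  { ins = 1 ; outs = 1 ; states = l
  ; t = λ _ s → toppT s
  ; o = λ _ s _ → toppO s
  ; init = q
  ; abelian = λ { zero zero s → refl , λ _ → refl } }

delayer : Component
delayer = record
  { ins = 1 ; outs = 1 ; states = 2
  ; t = λ _ _ → suc zero
  ; o = λ { _ zero _ → 0 ; _ (suc zero) _ → 1 }
  ; init = zero
  ; abelian = λ { zero zero s → refl , λ _ → refl } }

adder : Component
adder = record
  { ins = 2 ; outs = 1 ; states = 1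
  ; t = λ _ s → s
  ; o = λ _ _ _ → 1
  ; init = zero
  ; abelian = λ i j q → refl , λ _ → refl }

splitter : Component
splitter = record
  { ins = 1 ; outs = 2 ; states = 1
  ; t = λ _ s → s
  ; o = λ _ _ _ → 1
  ; init = zero
  ; abelian = λ i j q → refl , λ _ → refl }

data Gate : Set where
  adderG splitterG : Gate
  toppler2G : Fin 2 → Gate

⟦_⟧G : Gate → Component
⟦ adderG ⟧G = adder
⟦ splitterG ⟧G = splitter
⟦ toppler2G q ⟧G = toppler 2 q

-- Edges are identified with their tails: either one of the a input edges
-- (input alphabet Fin a) or an output port of a node.  Each edge has a head:
-- an input port of a node, one of the b network output edges, or trash.

Src : (a n : ℕ) → (Fin n → ℕ) → Set
Src a n outs' = Fin a ⊎ Σ (Fin n) (λ i → Fin (outs' i))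

data Dst (b n : ℕ) (ins' : Fin n → ℕ) : Set where
  inPort : (i : Fin n) → Fin (ins' i) → Dst b n ins'
  out    : Fin b → Dst b n ins'
  trash  : Dst b n ins'

record Network (K : Set) (I : K → Component) (a b : ℕ) : Set where
  field
    n    : ℕ
    node : Fin n → K
    dest : Src a n (λ i → outs (I (node i))) → Dst b n (λ i → ins (I (node i)))
    inWire  : ∀ i p → ∃! _≡_ (λ s → dest s ≡ inPort i p)
    outWire : ∀ c → ∃! _≡_ (λ s → dest s ≡ out c)

module Dynamics {K : Set} {I : K → Component} {a b : ℕ} (N : Network K I a b) where
  open Network N

  Cmp : Fin n → Component
  Cmp i = I (node i)

  S : Set
  S = Src a n (λ i → outs (Cmp i))

  record Config : Set where
    field
      st  : (i : Fin n) → Fin (states (Cmp i))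
      cnt : S → ℕ
  open Config public

  δ : S → S → ℕ
  δ (inj₁ x) (inj₁ y) with x ≟ y
  ... | yes _ = 1
  ... | no _  = 0
  δ (inj₁ _) (inj₂ _) = 0
  δ (inj₂ _) (inj₁ _) = 0
  δ (inj₂ (i , r)) (inj₂ (j , r')) with i ≟ j
  ... | no _ = 0
  ... | yes refl with r ≟ r'
  ...   | yes _ = 1
  ...   | no _  = 0

  emitted : Config → (i : Fin n) → Fin (ins (Cmp i)) → S → ℕ
  emitted c i p (inj₁ _) = 0
  emitted c i p (inj₂ (j , r)) with i ≟ j
  ... | yes refl = o (Cmp i) p (st c i) r
  ... | no _     = 0

  data Step (c c' : Config) : Set where
    fire : (s : S) (i : Fin n) (p : Fin (ins (Cmp i)))
         → dest s ≡ inPort i p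
         → 1 ≤ cnt c s
         → st c' i ≡ t (Cmp i) p (st c i)
         → (∀ j → j ≢ i → st c' j ≡ st c j)
         → (∀ s' → cnt c' s' + δ s s' ≡ cnt c s' + emitted c i p s')
         → Step c c'

  initial : (Fin a → ℕ) → Config
  initial x = record { st = λ i → init (Cmp i)
                     ; cnt = λ { (inj₁ e) → x e ; (inj₂ _) → 0 } }

  Halted : Config → Set
  Halted c = ∀ s i p → dest s ≡ inPort i p → cnt c s ≡ 0

  output : Config → Fin b → ℕ
  output c e = cnt c (Data.Product.proj₁ (outWire e))

  Computes : ((Fin a → ℕ) → Fin b → ℕ) → Set
  Computes F = ∀ x → (∃ λ c → Star Step (initial x) c × Halted c)
                   × (∀ c → Star Step (initial x) c → Halted c → ∀ e → output c e ≡ F x e)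

Emulates : ∀ {K I} (P : Component) → Network K I (ins P) (outs P) → Set
Emulates P N = Dynamics.Computes N (procFun P)

{-# OPTIONS --safe #-}
module Submission where

-- A 2-toppler halves its input, keeping the carry in its state.  The networks
-- are chains of stages, each a 2-toppler feeding the rest of the chain; in a
-- looped stage the output of the rest of the chain is moreover split and one
-- copy is returned through an adder to the stage's own toppler, which turns
-- division by 2λ into division by 2λ - 1.  Following the binary expansion of λ
-- gives a chain of period λ whose initial toppler states encode the state q;
-- a single looped stage is a delayer.
--
-- Correctness is proved with potentials (weighted counts of letters and
-- states) instead of order independence.  Weighting each letter by the number
-- of input letters it stands for and each toppler state by its carry gives a
-- value that every firing conserves: x + r₀ on input x, where r₀ is the value
-- of the initial states.  The innermost toppler's emissions are exactly the
-- output letters at halting, and from its first emission on the value held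
-- inside the network stays at least the offset m; hence at halting
-- x + r₀ = λ y + Φ with Φ < m + λ, and m ≤ Φ unless y = 0, so that
-- y = ⌊(x + r₀ - m) / λ⌋.  A distance-to-output potential decreases at every
-- firing except the innermost toppler's emissions, which lower the held value.

open import Defs
open import Data.Empty using (⊥-elim)
open import Data.Fin using (Fin; zero; suc; toℕ; fromℕ<; _≟_)
open import Data.Fin.Properties using (punchInᵢ≢i; any?; toℕ<n; toℕ-fromℕ<)
open import Data.List using (List; []; _∷_; length; replicate)
open import Data.List.Properties using (++-identityʳ)
open import Data.Nat using (ℕ; zero; suc; _+_; _*_; _∸_; _^_; _/_; _≤_; _<_; z≤n; s≤s; _≤?_; _<?_; NonZero)
open import Data.Nat.DivMod using (+-distrib-/-∣ˡ; m*n/n≡m; m<n⇒m/n≡0; m/n≡1+[m∸n]/n; /-congʳ; n/1≡n)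
open import Data.Nat.Divisibility using (divides-refl)
open import Data.Nat.Induction using (<-wellFounded)
open import Data.Nat.Properties hiding (_≟_)
open import Data.Nat.Tactic.RingSolver using (solve-∀)
open import Data.Product using (Σ; _,_; _×_; ∃; proj₁; proj₂)
open import Data.Product.Properties using () renaming (≡-dec to Σ-≡-dec)
open import Data.Sum using (_⊎_; inj₁; inj₂; [_,_]′)
open import Data.Sum.Properties using () renaming (≡-dec to ⊎-≡-dec)
open import Data.Vec.Functional using (removeAt)
open import Function using (_∘_)
open import Induction.WellFounded using (Acc; acc)
open import Relation.Binary.Construct.Closure.ReflexiveTransitive using (Star; ε; _◅_)
open import Relation.Binary.Definitions using (DecidableEquality)
open import Relation.Binary.PropositionalEquality
open import Relation.Nullary using (yes; no; Dec)
open import Relation.Nullary.Decidable using (_⊎-dec_; map′)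
open import Algebra.Properties.CommutativeSemigroup +-commutativeSemigroup
  using (interchange; xy∙z≈zy∙x; xy∙z≈xz∙y; x∙yz≈xz∙y)
open import Algebra.Properties.Semiring.Sum +-*-semiring
  using (sum; sum-cong-≗; ∑-distrib-+; *-distribˡ-sum; sum-remove)

-- Finite sums

sum-zero : ∀ {n} (f : Fin n → ℕ) → (∀ i → f i ≡ 0) → sum f ≡ 0
sum-zero {zero}  f f≡0 = refl
sum-zero {suc n} f f≡0 = cong₂ _+_ (f≡0 zero) (sum-zero (f ∘ suc) (f≡0 ∘ suc))

sum-single : ∀ {n} (f : Fin n → ℕ) i → (∀ j → j ≢ i → f j ≡ 0) → sum f ≡ f i
sum-single {suc n} f i others = begin
  sum f                     ≡⟨ sum-remove {i = i} f ⟩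
  f i + sum (removeAt f i)  ≡⟨ cong (f i +_) (sum-zero _ (λ j → others _ (punchInᵢ≢i i j))) ⟩
  f i + 0                   ≡⟨ +-identityʳ (f i) ⟩
  f i                       ∎
  where open ≡-Reasoning

sum-update : ∀ {n} (f g : Fin n → ℕ) i → (∀ j → j ≢ i → f j ≡ g j) → sum f + g i ≡ sum g + f i
sum-update {suc n} f g i agree = begin
  sum f + g i                     ≡⟨ cong (_+ g i) (sum-remove {i = i} f) ⟩
  f i + sum (removeAt f i) + g i  ≡⟨ cong (λ m → f i + m + g i) (sum-cong-≗ (λ j → agree _ (punchInᵢ≢i i j))) ⟩
  f i + sum (removeAt g i) + g i  ≡⟨ xy∙z≈zy∙x (f i) _ (g i) ⟩
  g i + sum (removeAt g i) + f i  ≡⟨ cong (_+ f i) (sum-remove {i = i} g) ⟨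
  sum g + f i                     ∎
  where open ≡-Reasoning

≤-sum : ∀ {n} (f : Fin n → ℕ) i → f i ≤ sum f
≤-sum {suc n} f i = ≤-trans (m≤m+n (f i) _) (≤-reflexive (sym (sum-remove {i = i} f)))

sum-linear : ∀ {m} k (f g h : Fin m → ℕ)
           → sum (λ r → (f r + k * g r) * h r) ≡ sum (λ r → f r * h r) + k * sum (λ r → g r * h r)
sum-linear k f g h = begin
  sum (λ r → (f r + k * g r) * h r)
    ≡⟨ sum-cong-≗ (λ r → trans (*-distribʳ-+ (h r) (f r) (k * g r)) (cong (f r * h r +_) (*-assoc k (g r) (h r)))) ⟩
  sum (λ r → f r * h r + k * (g r * h r))
    ≡⟨ ∑-distrib-+ (λ r → f r * h r) (λ r → k * (g r * h r)) ⟩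
  sum (λ r → f r * h r) + sum (λ r → k * (g r * h r))
    ≡⟨ cong (sum (λ r → f r * h r) +_) (*-distribˡ-sum k (λ r → g r * h r)) ⟨
  sum (λ r → f r * h r) + k * sum (λ r → g r * h r) ∎
  where open ≡-Reasoning

scale-balance : ∀ k {m} (f g : Fin m → ℕ) {x y z} → x + y ≡ sum (λ r → f r * g r) + z
              → k * x + k * y ≡ sum (λ r → k * f r * g r) + k * z
scale-balance k f g {x} {y} {z} balanced = begin
  k * x + k * y                         ≡⟨ *-distribˡ-+ k x y ⟨
  k * (x + y)                           ≡⟨ cong (k *_) balanced ⟩
  k * (sum (λ r → f r * g r) + z)       ≡⟨ *-distribˡ-+ k _ z ⟩
  k * sum (λ r → f r * g r) + k * z     ≡⟨ cong (_+ k * z) (*-distribˡ-sum k (λ r → f r * g r)) ⟩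
  sum (λ r → k * (f r * g r)) + k * z   ≡⟨ cong (_+ k * z) (sum-cong-≗ (λ r → *-assoc k (f r) (g r))) ⟨
  sum (λ r → k * f r * g r) + k * z     ∎
  where open ≡-Reasoning

-- Potentials on abelian networks

Star-preserves : ∀ {A : Set} {R : A → A → Set} (P : A → Set)
               → (∀ {x y} → P x → R x y → P y) → ∀ {x y} → P x → Star R x y → P y
Star-preserves P pres px ε          = px
Star-preserves P pres px (r ◅ path) = Star-preserves P pres (pres px r) path

module Potential {K : Set} {I : K → Component} {a b : ℕ} (N : Network K I a b) where
  open Network N
  open Dynamics N

  Σₑ : (S → ℕ) → ℕ
  Σₑ f = sum (f ∘ inj₁) + sum (λ i → sum (λ r → f (inj₂ (i , r))))

  Σₑ-cong : ∀ {f g : S → ℕ} → (∀ s → f s ≡ g s) → Σₑ f ≡ Σₑ g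
  Σₑ-cong f≡g = cong₂ _+_ (sum-cong-≗ (f≡g ∘ inj₁))
                          (sum-cong-≗ (λ i → sum-cong-≗ (λ r → f≡g (inj₂ (i , r)))))

  Σₑ-+ : ∀ (f g : S → ℕ) → Σₑ (λ s → f s + g s) ≡ Σₑ f + Σₑ g
  Σₑ-+ f g = begin
    Σₑ (λ s → f s + g s)
      ≡⟨ cong (sum (λ x → f (inj₁ x) + g (inj₁ x)) +_)
              (trans (sum-cong-≗ (λ i → ∑-distrib-+ (λ r → f (inj₂ (i , r))) (λ r → g (inj₂ (i , r)))))
                     (∑-distrib-+ (λ i → sum (λ r → f (inj₂ (i , r)))) (λ i → sum (λ r → g (inj₂ (i , r)))))) ⟩
    sum (λ x → f (inj₁ x) + g (inj₁ x)) + (Fₙ + Gₙ)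
      ≡⟨ cong (_+ (Fₙ + Gₙ)) (∑-distrib-+ (f ∘ inj₁) (g ∘ inj₁)) ⟩
    (sum (f ∘ inj₁) + sum (g ∘ inj₁)) + (Fₙ + Gₙ)
      ≡⟨ interchange (sum (f ∘ inj₁)) _ Fₙ Gₙ ⟩
    Σₑ f + Σₑ g ∎
    where
    open ≡-Reasoning
    Fₙ = sum (λ i → sum (λ r → f (inj₂ (i , r))))
    Gₙ = sum (λ i → sum (λ r → g (inj₂ (i , r))))

  Σₑ-* : ∀ k (f : S → ℕ) → Σₑ (λ s → k * f s) ≡ k * Σₑ f
  Σₑ-* k f = begin
    Σₑ (λ s → k * f s)
      ≡⟨ cong₂ _+_ (*-distribˡ-sum k (f ∘ inj₁))
                   (trans (*-distribˡ-sum k (λ i → sum (λ r → f (inj₂ (i , r)))))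
                          (sum-cong-≗ (λ i → *-distribˡ-sum k (λ r → f (inj₂ (i , r)))))) ⟨
    k * sum (f ∘ inj₁) + k * sum (λ i → sum (λ r → f (inj₂ (i , r))))
      ≡⟨ *-distribˡ-+ k _ _ ⟨
    k * Σₑ f ∎
    where open ≡-Reasoning

  Σₑ-single : ∀ (f : S → ℕ) s → (∀ s' → s' ≢ s → f s' ≡ 0) → Σₑ f ≡ f s
  Σₑ-single f (inj₁ x) others =
    trans (cong₂ _+_ (sum-single (f ∘ inj₁) x (λ y y≢x → others (inj₁ y) (λ { refl → y≢x refl })))
                     (sum-zero _ (λ i → sum-zero _ (λ r → others (inj₂ (i , r)) λ ()))))
          (+-identityʳ _)
  Σₑ-single f (inj₂ (i , r)) others =
    cong₂ _+_ (sum-zero (f ∘ inj₁) (λ y → others (inj₁ y) λ ()))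
              (trans (sum-single _ i (λ j j≢i → sum-zero _ (λ r' → others (inj₂ (j , r')) (λ { refl → j≢i refl }))))
                     (sum-single _ r (λ r' r'≢r → others (inj₂ (i , r')) (λ { refl → r'≢r refl }))))

  ≤-Σₑ : ∀ (f : S → ℕ) s → f s ≤ Σₑ f
  ≤-Σₑ f (inj₁ x)       = ≤-trans (≤-sum (f ∘ inj₁) x) (m≤m+n _ _)
  ≤-Σₑ f (inj₂ (i , r)) = ≤-trans (≤-sum (λ r' → f (inj₂ (i , r'))) r)
                                  (≤-trans (≤-sum (λ j → sum (λ r' → f (inj₂ (j , r')))) i) (m≤n+m _ _))

  _≟ₑ_ : DecidableEquality S
  _≟ₑ_ = ⊎-≡-dec _≟_ (Σ-≡-dec _≟_ _≟_)

  δ-self : ∀ s → δ s s ≡ 1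
  δ-self (inj₁ x) with x ≟ x
  ... | yes _  = refl
  ... | no x≢x = ⊥-elim (x≢x refl)
  δ-self (inj₂ (i , r)) with i ≟ i
  ... | no i≢i = ⊥-elim (i≢i refl)
  ... | yes refl with r ≟ r
  ...   | yes _  = refl
  ...   | no r≢r = ⊥-elim (r≢r refl)

  δ-other : ∀ s s' → s ≢ s' → δ s s' ≡ 0
  δ-other (inj₁ x) (inj₁ y) x≢y with x ≟ y
  ... | yes refl = ⊥-elim (x≢y refl)
  ... | no _     = refl
  δ-other (inj₁ _) (inj₂ _) _ = refl
  δ-other (inj₂ _) (inj₁ _) _ = refl
  δ-other (inj₂ (i , r)) (inj₂ (j , r')) s≢s' with i ≟ j
  ... | no _ = refl
  ... | yes refl with r ≟ r'
  ...   | yes refl = ⊥-elim (s≢s' refl)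
  ...   | no _     = refl

  δ-sym : ∀ s s' → δ s s' ≡ δ s' s
  δ-sym s s' with s ≟ₑ s'
  ... | yes refl = refl
  ... | no s≢s'  = trans (δ-other s s' s≢s') (sym (δ-other s' s (s≢s' ∘ sym)))

  emitted-self : ∀ c i p r → emitted c i p (inj₂ (i , r)) ≡ o (Cmp i) p (st c i) r
  emitted-self c i p r with i ≟ i
  ... | yes refl = refl
  ... | no i≢i   = ⊥-elim (i≢i refl)

  emitted-other : ∀ c i p j r → i ≢ j → emitted c i p (inj₂ (j , r)) ≡ 0
  emitted-other c i p j r i≢j with i ≟ j
  ... | yes refl = ⊥-elim (i≢j refl)
  ... | no _     = refl

  StateWeights : Set
  StateWeights = (i : Fin n) → Fin (states (Cmp i)) → ℕ

  load : (S → ℕ) → Config → ℕ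
  load w c = Σₑ (λ s → w s * cnt c s)

  stateSum : StateWeights → Config → ℕ
  stateSum φ c = sum (λ i → φ i (st c i))

  V : (S → ℕ) → StateWeights → Config → ℕ
  V w φ c = load w c + stateSum φ c

  emittedLoad : (S → ℕ) → Config → (i : Fin n) → Fin (ins (Cmp i)) → ℕ
  emittedLoad w c i p = sum (λ r → w (inj₂ (i , r)) * o (Cmp i) p (st c i) r)

  load-cong : ∀ {w w' : S → ℕ} → (∀ s → w s ≡ w' s) → ∀ c → load w c ≡ load w' c
  load-cong w≡w' c = Σₑ-cong (λ s → cong (_* cnt c s) (w≡w' s))

  load-+ : ∀ (w w' : S → ℕ) c → load (λ s → w s + w' s) c ≡ load w c + load w' c
  load-+ w w' c = trans (Σₑ-cong (λ s → *-distribʳ-+ (cnt c s) (w s) (w' s)))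
                        (Σₑ-+ (λ s → w s * cnt c s) (λ s → w' s * cnt c s))

  load-* : ∀ k (w : S → ℕ) c → load (λ s → k * w s) c ≡ k * load w c
  load-* k w c = trans (Σₑ-cong (λ s → *-assoc k (w s) (cnt c s))) (Σₑ-* k (λ s → w s * cnt c s))

  Σₑ-δ : ∀ (f : S → ℕ) s → Σₑ (λ s' → f s' * δ s s') ≡ f s
  Σₑ-δ f s =
    trans (Σₑ-single _ s (λ s' s'≢s → trans (cong (f s' *_) (δ-other s s' (s'≢s ∘ sym))) (*-zeroʳ (f s'))))
                   (trans (cong (f s *_) (δ-self s)) (*-identityʳ (f s)))

  Σₑ-emitted : ∀ (w : S → ℕ) c i p → Σₑ (λ s → w s * emitted c i p s) ≡ emittedLoad w c i p
  Σₑ-emitted w c i p =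
    cong₂ _+_ (sum-zero _ (λ x → *-zeroʳ (w (inj₁ x))))
              (trans (sum-single _ i (λ j j≢i → sum-zero _ (λ r → not-emitting j r (j≢i ∘ sym))))
                     (sum-cong-≗ (λ r → cong (w (inj₂ (i , r)) *_) (emitted-self c i p r))))
    where
    not-emitting : ∀ j r → i ≢ j → w (inj₂ (j , r)) * emitted c i p (inj₂ (j , r)) ≡ 0
    not-emitting j r i≢j = trans (cong (w (inj₂ (j , r)) *_) (emitted-other c i p j r i≢j)) (*-zeroʳ (w (inj₂ (j , r))))

  load-δ : ∀ s c → load (δ s) c ≡ cnt c s
  load-δ s c = trans (Σₑ-cong (λ s' → *-comm (δ s s') (cnt c s'))) (Σₑ-δ (cnt c) s)

  ≤-load : ∀ w c s → w s * cnt c s ≤ load w c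
  ≤-load w c = ≤-Σₑ (λ s → w s * cnt c s)

  ≤-V : ∀ w φ c s i → 1 ≤ cnt c s → w s + φ i (st c i) ≤ V w φ c
  ≤-V w φ c s i nonempty =
    +-mono-≤ (≤-trans (≤-reflexive (sym (*-identityʳ (w s)))) (≤-trans (*-monoʳ-≤ (w s) nonempty) (≤-load w c s)))
             (≤-sum (λ j → φ j (st c j)) i)

  load-initial : ∀ w x → load w (initial x) ≡ sum (λ e → w (inj₁ e) * x e)
  load-initial w x = trans (cong (sum (λ e → w (inj₁ e) * x e) +_)
                                 (sum-zero _ (λ i → sum-zero _ (λ r → *-zeroʳ (w (inj₂ (i , r)))))))
                           (+-identityʳ _)

  Internal : S → Set
  Internal s = ∃ λ i → ∃ λ p → dest s ≡ inPort i p

  load-halted : ∀ w c e → Halted c → (∀ s → s ≢ e → Internal s) → load w c ≡ w e * cnt c e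
  load-halted w c e halted internal = Σₑ-single _ e emptied
    where
    emptied : ∀ s → s ≢ e → w s * cnt c s ≡ 0
    emptied s s≢e with internal s s≢e
    ... | i , p , feeds = trans (cong (w s *_) (halted s i p feeds)) (*-zeroʳ (w s))

  load-fire : ∀ w {c c'} s i p → (∀ s' → cnt c' s' + δ s s' ≡ cnt c s' + emitted c i p s')
            → load w c' + w s ≡ load w c + emittedLoad w c i p
  load-fire w {c} {c'} s i p balance = begin
    load w c' + w s
      ≡⟨ cong (load w c' +_) (Σₑ-δ w s) ⟨
    load w c' + Σₑ (λ s' → w s' * δ s s')
      ≡⟨ Σₑ-+ (λ s' → w s' * cnt c' s') (λ s' → w s' * δ s s') ⟨
    Σₑ (λ s' → w s' * cnt c' s' + w s' * δ s s')
      ≡⟨ Σₑ-cong (λ s' → trans (sym (*-distribˡ-+ (w s') (cnt c' s') (δ s s')))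
                              (trans (cong (w s' *_) (balance s')) (*-distribˡ-+ (w s') (cnt c s') _))) ⟩
    Σₑ (λ s' → w s' * cnt c s' + w s' * emitted c i p s')
      ≡⟨ Σₑ-+ (λ s' → w s' * cnt c s') (λ s' → w s' * emitted c i p s') ⟩
    load w c + Σₑ (λ s' → w s' * emitted c i p s')
      ≡⟨ cong (load w c +_) (Σₑ-emitted w c i p) ⟩
    load w c + emittedLoad w c i p ∎
    where open ≡-Reasoning

  stateSum-fire : ∀ φ {c c'} i → (∀ j → j ≢ i → st c' j ≡ st c j)
                → stateSum φ c' + φ i (st c i) ≡ stateSum φ c + φ i (st c' i)
  stateSum-fire φ {c} {c'} i others = sum-update _ _ i (λ j j≢i → cong (φ j) (others j j≢i))

  V-fire : ∀ w φ {c c'} s i p → st c' i ≡ t (Cmp i) p (st c i) → (∀ j → j ≢ i → st c' j ≡ st c j)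
         → (∀ s' → cnt c' s' + δ s s' ≡ cnt c s' + emitted c i p s')
         → V w φ c' + (w s + φ i (st c i)) ≡ V w φ c + (emittedLoad w c i p + φ i (t (Cmp i) p (st c i)))
  V-fire w φ {c} {c'} s i p moved others balance = begin
    V w φ c' + (w s + φ i (st c i))
      ≡⟨ interchange (load w c') (stateSum φ c') (w s) _ ⟩
    (load w c' + w s) + (stateSum φ c' + φ i (st c i))
      ≡⟨ cong₂ _+_ (load-fire w {c} {c'} s i p balance) (stateSum-fire φ {c} {c'} i others) ⟩
    (load w c + emittedLoad w c i p) + (stateSum φ c + φ i (st c' i))
      ≡⟨ cong (λ q → (load w c + emittedLoad w c i p) + (stateSum φ c + φ i q)) moved ⟩
    (load w c + emittedLoad w c i p) + (stateSum φ c + φ i (t (Cmp i) p (st c i)))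
      ≡⟨ interchange (load w c) (emittedLoad w c i p) (stateSum φ c) _ ⟩
    V w φ c + (emittedLoad w c i p + φ i (t (Cmp i) p (st c i))) ∎
    where open ≡-Reasoning

  Pending : Config → S → Set
  Pending c s = ∃ λ i → ∃ λ p → dest s ≡ inPort i p × 1 ≤ cnt c s

  pending? : ∀ c s → Dec (Pending c s)
  pending? c s with dest s
  ... | inPort i p = map′ (λ nonempty → i , p , refl , nonempty) (proj₂ ∘ proj₂ ∘ proj₂) (1 ≤? cnt c s)
  ... | out _      = no λ { (_ , _ , () , _) }
  ... | trash      = no λ { (_ , _ , () , _) }

  any-pending? : ∀ c → Dec (∃ (Pending c))
  any-pending? c = map′ [ (λ (x , p) → inj₁ x , p) , (λ (i , r , p) → inj₂ (i , r) , p) ]′ split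
                        (any? (pending? c ∘ inj₁) ⊎-dec any? (λ i → any? (λ r → pending? c (inj₂ (i , r)))))
    where
    split : ∃ (Pending c) → ∃ (Pending c ∘ inj₁) ⊎ ∃ λ i → ∃ λ r → Pending c (inj₂ (i , r))
    split (inj₁ x , p)       = inj₁ (x , p)
    split (inj₂ (i , r) , p) = inj₂ (i , r , p)

  fireState : Config → (i : Fin n) → Fin (ins (Cmp i)) → (j : Fin n) → Fin (states (Cmp j))
  fireState c i p j with j ≟ i
  ... | yes refl = t (Cmp i) p (st c i)
  ... | no _     = st c j

  fireState-self : ∀ c i p → fireState c i p i ≡ t (Cmp i) p (st c i)
  fireState-self c i p with i ≟ i
  ... | yes refl = refl
  ... | no i≢i   = ⊥-elim (i≢i refl)

  fireState-other : ∀ c i p j → j ≢ i → fireState c i p j ≡ st c j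
  fireState-other c i p j j≢i with j ≟ i
  ... | yes refl = ⊥-elim (j≢i refl)
  ... | no _     = refl

  fireConfig : Config → S → (i : Fin n) → Fin (ins (Cmp i)) → Config
  fireConfig c s i p = record
    { st  = fireState c i p
    ; cnt = λ s' → cnt c s' + emitted c i p s' ∸ δ s s' }

  fire-step : ∀ c s i p → dest s ≡ inPort i p → 1 ≤ cnt c s → Step c (fireConfig c s i p)
  fire-step c s i p feeds nonempty =
    fire s i p feeds nonempty (fireState-self c i p) (fireState-other c i p) balance
    where
    balance : ∀ s' → cnt c s' + emitted c i p s' ∸ δ s s' + δ s s' ≡ cnt c s' + emitted c i p s'
    balance s' with s ≟ₑ s'
    ... | yes refl rewrite δ-self s = m∸n+n≡m (≤-trans nonempty (m≤m+n (cnt c s) _))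
    ... | no s≢s'  rewrite δ-other s s' s≢s' = +-identityʳ _

  progress : ∀ c → Halted c ⊎ ∃ (Step c)
  progress c with any-pending? c
  ... | yes (s , i , p , feeds , nonempty) = inj₂ (_ , fire-step c s i p feeds nonempty)
  ... | no none = inj₁ λ s i p feeds → n≤0⇒n≡0 (≮⇒≥ λ nonempty → none (s , i , p , feeds , nonempty))

  halting-run : (μ : Config → ℕ) (Inv : Config → Set)
              → (∀ {c c'} → Inv c → Step c c' → Inv c' × μ c' < μ c)
              → ∀ c → Inv c → ∃ λ h → Star Step c h × Halted h
  halting-run μ Inv decreasing c inv = go c (<-wellFounded (μ c)) inv
    where
    go : ∀ c → Acc _<_ (μ c) → Inv c → ∃ λ h → Star Step c h × Halted h
    go c (acc smaller) inv with progress c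
    ... | inj₁ halted = c , ε , halted
    ... | inj₂ (c' , step) with decreasing inv step
    ...   | inv' , μ↓ with go c' (smaller μ↓) inv'
    ...     | h , run , halted = h , step ◅ run , halted

Computes-cong : ∀ {K I a b} (N : Network K I a b) {F G : (Fin a → ℕ) → Fin b → ℕ}
              → (∀ x e → F x e ≡ G x e) → Dynamics.Computes N F → Dynamics.Computes N G
Computes-cong N F≡G computes x =
  proj₁ (computes x) , λ c run halted e → trans (proj₂ (computes x) c run halted e) (F≡G x e)

-- Chains of halving stages

-- A looped halver has an adder (node 0) in front of its toppler (node 1) and a
-- splitter (node 2) behind the rest of the chain, whose port 1 returns to port 1
-- of the adder.
data Stage : Set where
  halver loopedHalver : Fin 2 → Stage

size : List Stage → ℕ
size []                   = 0
size (halver _ ∷ r)       = 1 + size r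
size (loopedHalver _ ∷ r) = 3 + size r

gate : (bs : List Stage) → Fin (size bs) → Gate
gate (halver s ∷ r)       zero                = toppler2G s
gate (halver s ∷ r)       (suc i)             = gate r i
gate (loopedHalver s ∷ r) zero                = adderG
gate (loopedHalver s ∷ r) (suc zero)          = toppler2G s
gate (loopedHalver s ∷ r) (suc (suc zero))    = splitterG
gate (loopedHalver s ∷ r) (suc (suc (suc i))) = gate r i

Edge : List Stage → Set
Edge bs = Src 1 (size bs) (λ i → outs ⟦ gate bs i ⟧G)

Head : List Stage → Set
Head bs = Dst 1 (size bs) (λ i → ins ⟦ gate bs i ⟧G)

lift : ∀ st {r} → Edge r → Edge (st ∷ r)
lift (halver _)       (inj₁ _)       = inj₂ (zero , zero)
lift (halver _)       (inj₂ (i , p)) = inj₂ (suc i , p)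
lift (loopedHalver _) (inj₁ _)       = inj₂ (suc zero , zero)
lift (loopedHalver _) (inj₂ (i , p)) = inj₂ (suc (suc (suc i)) , p)

liftHead : ∀ st {r} → Head r → Head (st ∷ r)
liftHead (halver _)       (inPort i p) = inPort (suc i) p
liftHead (halver _)       (out e)      = out e
liftHead (loopedHalver _) (inPort i p) = inPort (suc (suc (suc i))) p
liftHead (loopedHalver _) (out _)      = inPort (suc (suc zero)) zero
liftHead _                trash        = trash

wiring : (bs : List Stage) → Edge bs → Head bs
wiring []                   (inj₁ _)                            = out zero
wiring (halver s ∷ r)       (inj₁ _)                            = inPort zero zero
wiring (halver s ∷ r)       (inj₂ (zero , _))                   = liftHead (halver s) (wiring r (inj₁ zero))
wiring (halver s ∷ r)       (inj₂ (suc i , p))                  = liftHead (halver s) (wiring r (inj₂ (i , p)))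
wiring (loopedHalver s ∷ r) (inj₁ _)                            = inPort zero zero
wiring (loopedHalver s ∷ r) (inj₂ (zero , _))                   = inPort (suc zero) zero
wiring (loopedHalver s ∷ r) (inj₂ (suc zero , _))               = liftHead (loopedHalver s) (wiring r (inj₁ zero))
wiring (loopedHalver s ∷ r) (inj₂ (suc (suc zero) , zero))      = out zero
wiring (loopedHalver s ∷ r) (inj₂ (suc (suc zero) , suc zero))  = inPort zero (suc zero)
wiring (loopedHalver s ∷ r) (inj₂ (suc (suc (suc i)) , p))      = liftHead (loopedHalver s) (wiring r (inj₂ (i , p)))

wiring-lift : ∀ st {r} (y : Edge r) → wiring (st ∷ r) (lift st y) ≡ liftHead st {r} (wiring r y)
wiring-lift (halver _)       (inj₁ zero) = refl
wiring-lift (halver _)       (inj₂ _)    = refl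
wiring-lift (loopedHalver _) (inj₁ zero) = refl
wiring-lift (loopedHalver _) (inj₂ _)    = refl

outEdge : (bs : List Stage) → Edge bs
outEdge []                   = inj₁ zero
outEdge (halver s ∷ r)       = lift (halver s) (outEdge r)
outEdge (loopedHalver s ∷ r) = inj₂ (suc (suc zero) , zero)

feeder : (bs : List Stage) (i : Fin (size bs)) → Fin (ins ⟦ gate bs i ⟧G) → Edge bs
feeder (halver s ∷ r)       zero                _        = inj₁ zero
feeder (halver s ∷ r)       (suc i)             p        = lift (halver s) (feeder r i p)
feeder (loopedHalver s ∷ r) zero                zero     = inj₁ zero
feeder (loopedHalver s ∷ r) zero                (suc _)  = inj₂ (suc (suc zero) , suc zero)
feeder (loopedHalver s ∷ r) (suc zero)          _        = inj₂ (zero , zero)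
feeder (loopedHalver s ∷ r) (suc (suc zero))    _        = lift (loopedHalver s) (outEdge r)
feeder (loopedHalver s ∷ r) (suc (suc (suc i))) p        = lift (loopedHalver s) (feeder r i p)

wiring-outEdge : ∀ bs → wiring bs (outEdge bs) ≡ out zero
wiring-outEdge []                   = refl
wiring-outEdge (halver s ∷ r)       = trans (wiring-lift (halver s) (outEdge r)) (cong (liftHead (halver s)) (wiring-outEdge r))
wiring-outEdge (loopedHalver s ∷ r) = refl

wiring-feeder : ∀ bs i p → wiring bs (feeder bs i p) ≡ inPort i p
wiring-feeder (halver s ∷ r)       zero                zero    = refl
wiring-feeder (halver s ∷ r)       (suc i)             p       =
  trans (wiring-lift (halver s) (feeder r i p)) (cong (liftHead (halver s)) (wiring-feeder r i p))
wiring-feeder (loopedHalver s ∷ r) zero                zero    = refl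
wiring-feeder (loopedHalver s ∷ r) zero                (suc zero) = refl
wiring-feeder (loopedHalver s ∷ r) (suc zero)          zero    = refl
wiring-feeder (loopedHalver s ∷ r) (suc (suc zero))    zero    =
  trans (wiring-lift (loopedHalver s) (outEdge r)) (cong (liftHead (loopedHalver s)) (wiring-outEdge r))
wiring-feeder (loopedHalver s ∷ r) (suc (suc (suc i))) p       =
  trans (wiring-lift (loopedHalver s) (feeder r i p)) (cong (liftHead (loopedHalver s)) (wiring-feeder r i p))

outEdge-unique : ∀ bs y → wiring bs y ≡ out zero → outEdge bs ≡ y
outEdge-lift : ∀ st r (y : Edge r) → liftHead st {r} (wiring r y) ≡ out zero → outEdge (st ∷ r) ≡ lift st y

outEdge-unique []                   (inj₁ zero)                       _  = refl
outEdge-unique (halver s ∷ r)       (inj₁ zero)                       ()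
outEdge-unique (halver s ∷ r)       (inj₂ (zero , zero))              eq = outEdge-lift (halver s) r (inj₁ zero) eq
outEdge-unique (halver s ∷ r)       (inj₂ (suc i , p))                eq = outEdge-lift (halver s) r (inj₂ (i , p)) eq
outEdge-unique (loopedHalver s ∷ r) (inj₁ zero)                       ()
outEdge-unique (loopedHalver s ∷ r) (inj₂ (zero , zero))              ()
outEdge-unique (loopedHalver s ∷ r) (inj₂ (suc zero , zero))          eq = outEdge-lift (loopedHalver s) r (inj₁ zero) eq
outEdge-unique (loopedHalver s ∷ r) (inj₂ (suc (suc zero) , zero))    _  = refl
outEdge-unique (loopedHalver s ∷ r) (inj₂ (suc (suc zero) , suc zero)) ()
outEdge-unique (loopedHalver s ∷ r) (inj₂ (suc (suc (suc i)) , p))    eq = outEdge-lift (loopedHalver s) r (inj₂ (i , p)) eq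

outEdge-lift (halver _) r y eq with wiring r y in wired
outEdge-lift (halver _) r y refl | out zero = cong (lift (halver _)) (outEdge-unique r y wired)
outEdge-lift (loopedHalver _) r y eq with wiring r y
outEdge-lift (loopedHalver _) r y () | inPort _ _
outEdge-lift (loopedHalver _) r y () | out _
outEdge-lift (loopedHalver _) r y () | trash

feeder-unique : ∀ bs y {i p} → wiring bs y ≡ inPort i p → feeder bs i p ≡ y
feeder-lift : ∀ st r (y : Edge r) {i p} → liftHead st {r} (wiring r y) ≡ inPort i p → feeder (st ∷ r) i p ≡ lift st y

feeder-unique []                   (inj₁ zero)                         ()
feeder-unique (halver s ∷ r)       (inj₁ zero)                         refl = refl
feeder-unique (halver s ∷ r)       (inj₂ (zero , zero))                eq   = feeder-lift (halver s) r (inj₁ zero) eq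
feeder-unique (halver s ∷ r)       (inj₂ (suc i , p))                  eq   = feeder-lift (halver s) r (inj₂ (i , p)) eq
feeder-unique (loopedHalver s ∷ r) (inj₁ zero)                         refl = refl
feeder-unique (loopedHalver s ∷ r) (inj₂ (zero , zero))                refl = refl
feeder-unique (loopedHalver s ∷ r) (inj₂ (suc zero , zero))            eq   = feeder-lift (loopedHalver s) r (inj₁ zero) eq
feeder-unique (loopedHalver s ∷ r) (inj₂ (suc (suc zero) , zero))      ()
feeder-unique (loopedHalver s ∷ r) (inj₂ (suc (suc zero) , suc zero))  refl = refl
feeder-unique (loopedHalver s ∷ r) (inj₂ (suc (suc (suc i)) , p))      eq   = feeder-lift (loopedHalver s) r (inj₂ (i , p)) eq

feeder-lift (halver s) r y eq with wiring r y in wired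
feeder-lift (halver s) r y refl | inPort _ _ = cong (lift (halver s)) (feeder-unique r y wired)
feeder-lift (loopedHalver s) r y eq with wiring r y in wired
feeder-lift (loopedHalver s) r y refl | inPort _ _ = cong (lift (loopedHalver s)) (feeder-unique r y wired)
feeder-lift (loopedHalver s) r y refl | out zero   = cong (lift (loopedHalver s)) (outEdge-unique r y wired)

wiring≢trash : ∀ bs y → wiring bs y ≢ trash
liftHead≢trash : ∀ st r (y : Edge r) → liftHead st {r} (wiring r y) ≢ trash

wiring≢trash []                   (inj₁ zero)                         ()
wiring≢trash (halver s ∷ r)       (inj₁ zero)                         ()
wiring≢trash (halver s ∷ r)       (inj₂ (zero , zero))                = liftHead≢trash (halver s) r (inj₁ zero)
wiring≢trash (halver s ∷ r)       (inj₂ (suc i , p))                  = liftHead≢trash (halver s) r (inj₂ (i , p))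
wiring≢trash (loopedHalver s ∷ r) (inj₁ zero)                         ()
wiring≢trash (loopedHalver s ∷ r) (inj₂ (zero , zero))                ()
wiring≢trash (loopedHalver s ∷ r) (inj₂ (suc zero , zero))            = liftHead≢trash (loopedHalver s) r (inj₁ zero)
wiring≢trash (loopedHalver s ∷ r) (inj₂ (suc (suc zero) , zero))      ()
wiring≢trash (loopedHalver s ∷ r) (inj₂ (suc (suc zero) , suc zero))  ()
wiring≢trash (loopedHalver s ∷ r) (inj₂ (suc (suc (suc i)) , p))      = liftHead≢trash (loopedHalver s) r (inj₂ (i , p))

liftHead≢trash st r y eq with wiring r y in wired
liftHead≢trash (halver _)       r y () | inPort _ _
liftHead≢trash (halver _)       r y () | out _
liftHead≢trash (loopedHalver _) r y () | inPort _ _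
liftHead≢trash (loopedHalver _) r y () | out _
liftHead≢trash st               r y _  | trash = wiring≢trash r y wired

chain : List Stage → Network Gate ⟦_⟧G 1 1
chain bs = record
  { n       = size bs
  ; node    = gate bs
  ; dest    = wiring bs
  ; inWire  = λ i p → feeder bs i p , wiring-feeder bs i p , feeder-unique bs _
  ; outWire = λ { zero → outEdge bs , wiring-outEdge bs , outEdge-unique bs _ } }

-- Potentials on chains

-- period is kept in the form suc _ so that it is visibly a nonzero divisor.
predPeriod : List Stage → ℕ
predPeriod []                   = 0
predPeriod (halver _ ∷ r)       = suc (2 * predPeriod r)
predPeriod (loopedHalver _ ∷ r) = 2 * predPeriod r

period : List Stage → ℕ
period bs = suc (predPeriod bs)

offset : List Stage → ℕ
offset []                   = 0
offset (halver _ ∷ r)       = 2 * offset r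
offset (loopedHalver _ ∷ r) = suc (2 * offset r)

initialValue : List Stage → ℕ
initialValue []                   = 0
initialValue (halver s ∷ r)       = toℕ s + 2 * initialValue r
initialValue (loopedHalver s ∷ r) = toℕ s + 2 * initialValue r

depth : List Stage → ℕ
depth []                   = 0
depth (halver _ ∷ r)       = 1 + depth r
depth (loopedHalver _ ∷ r) = 2 + depth r

loopDelay : List Stage → ℕ
loopDelay []                   = 0
loopDelay (halver _ ∷ r)       = loopDelay r
loopDelay (loopedHalver _ ∷ r) = loopDelay r + (3 + depth r)

-- The number of input letters a letter on the edge stands for.
value : (bs : List Stage) → Edge bs → ℕ
value []                   _                                        = 1
value (halver s ∷ r)       (inj₁ _)                                 = 1
value (halver s ∷ r)       (inj₂ (zero , _))                        = 2 * value r (inj₁ zero)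
value (halver s ∷ r)       (inj₂ (suc i , p))                       = 2 * value r (inj₂ (i , p))
value (loopedHalver s ∷ r) (inj₁ _)                                 = 1
value (loopedHalver s ∷ r) (inj₂ (zero , _))                        = 1
value (loopedHalver s ∷ r) (inj₂ (suc zero , _))                    = 2 * value r (inj₁ zero)
value (loopedHalver s ∷ r) (inj₂ (suc (suc zero) , zero))           = period (loopedHalver s ∷ r)
value (loopedHalver s ∷ r) (inj₂ (suc (suc zero) , suc zero))       = 1
value (loopedHalver s ∷ r) (inj₂ (suc (suc (suc i)) , p))           = 2 * value r (inj₂ (i , p))

-- 1 on the edges carrying emissions of the innermost toppler towards the
-- output (feedback copies excluded), so its load counts these emissions.
emitWeight : (bs : List Stage) → Edge bs → ℕ
emitWeight []                   _                                   = 1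
emitWeight (halver s ∷ r)       (inj₁ _)                            = 0
emitWeight (halver s ∷ r)       (inj₂ (zero , _))                   = emitWeight r (inj₁ zero)
emitWeight (halver s ∷ r)       (inj₂ (suc i , p))                  = emitWeight r (inj₂ (i , p))
emitWeight (loopedHalver s ∷ r) (inj₁ _)                            = 0
emitWeight (loopedHalver s ∷ r) (inj₂ (zero , _))                   = 0
emitWeight (loopedHalver s ∷ r) (inj₂ (suc zero , _))               = emitWeight r (inj₁ zero)
emitWeight (loopedHalver s ∷ r) (inj₂ (suc (suc zero) , zero))      = 1
emitWeight (loopedHalver s ∷ r) (inj₂ (suc (suc zero) , suc zero))  = 0
emitWeight (loopedHalver s ∷ r) (inj₂ (suc (suc (suc i)) , p))      = emitWeight r (inj₂ (i , p))

-- Bounds the firings a letter still causes, apart from the rounds through the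
-- loops caused by later emissions of the innermost toppler (see loopDelay).
distance : (bs : List Stage) → Edge bs → ℕ
distance []                   _                                  = 0
distance (halver s ∷ r)       (inj₁ _)                           = suc (depth r)
distance (halver s ∷ r)       (inj₂ (zero , _))                  = distance r (inj₁ zero)
distance (halver s ∷ r)       (inj₂ (suc i , p))                 = distance r (inj₂ (i , p))
distance (loopedHalver s ∷ r) (inj₁ _)                           = 2 + depth r
distance (loopedHalver s ∷ r) (inj₂ (zero , _))                  = 1 + depth r
distance (loopedHalver s ∷ r) (inj₂ (suc zero , _))              =
  distance r (inj₁ zero) + (3 + depth r) * emitWeight r (inj₁ zero)
distance (loopedHalver s ∷ r) (inj₂ (suc (suc zero) , zero))     = 0
distance (loopedHalver s ∷ r) (inj₂ (suc (suc zero) , suc zero)) = 2 + depth r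
distance (loopedHalver s ∷ r) (inj₂ (suc (suc (suc i)) , p))     =
  distance r (inj₂ (i , p)) + (3 + depth r) * emitWeight r (inj₂ (i , p))

stateValue : (bs : List Stage) → Potential.StateWeights (chain bs)
stateValue (halver s ∷ r)       zero                q = toℕ q
stateValue (halver s ∷ r)       (suc i)             q = 2 * stateValue r i q
stateValue (loopedHalver s ∷ r) (suc zero)          q = toℕ q
stateValue (loopedHalver s ∷ r) (suc (suc (suc i))) q = 2 * stateValue r i q
stateValue (loopedHalver s ∷ r) _                   q = 0

emitGain : (bs : List Stage) → Potential.StateWeights (chain bs)
emitGain (halver s ∷ r)       zero                q = emitWeight r (inj₁ zero) * toℕ q
emitGain (halver s ∷ r)       (suc i)             q = emitGain r i q
emitGain (loopedHalver s ∷ r) (suc zero)          q = emitWeight r (inj₁ zero) * toℕ q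
emitGain (loopedHalver s ∷ r) (suc (suc (suc i))) q = emitGain r i q
emitGain (loopedHalver s ∷ r) _                   q = 0

period-halver : ∀ s r → period (halver s ∷ r) ≡ 2 * period r
period-halver s r = sym (*-suc 2 (predPeriod r))

offset+period : ∀ bs → offset bs + period bs ≡ 2 ^ length bs
offset+period []                   = refl
offset+period (halver s ∷ r)       = trans (double-sum (offset r) (predPeriod r)) (cong (2 *_) (offset+period r))
  where
  double-sum : ∀ m k → 2 * m + suc (suc (2 * k)) ≡ 2 * (m + suc k)
  double-sum = solve-∀
offset+period (loopedHalver s ∷ r) = trans (double-sum (offset r) (predPeriod r)) (cong (2 *_) (offset+period r))
  where
  double-sum : ∀ m k → suc (2 * m) + suc (2 * k) ≡ 2 * (m + suc k)
  double-sum = solve-∀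

value-lift : ∀ st r (y : Edge r) → value (st ∷ r) (lift st y) ≡ 2 * value r y
value-lift (halver _)       r (inj₁ zero) = refl
value-lift (halver _)       r (inj₂ _)    = refl
value-lift (loopedHalver _) r (inj₁ zero) = refl
value-lift (loopedHalver _) r (inj₂ _)    = refl

emitWeight-lift : ∀ st r (y : Edge r) → emitWeight (st ∷ r) (lift st y) ≡ emitWeight r y
emitWeight-lift (halver _)       r (inj₁ zero) = refl
emitWeight-lift (halver _)       r (inj₂ _)    = refl
emitWeight-lift (loopedHalver _) r (inj₁ zero) = refl
emitWeight-lift (loopedHalver _) r (inj₂ _)    = refl

distance-lift-halver : ∀ s r (y : Edge r) → distance (halver s ∷ r) (lift (halver s) y) ≡ distance r y
distance-lift-halver s r (inj₁ zero) = refl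
distance-lift-halver s r (inj₂ _)    = refl

distance-lift-looped : ∀ s r (y : Edge r)
                     → distance (loopedHalver s ∷ r) (lift (loopedHalver s) y) ≡ distance r y + (3 + depth r) * emitWeight r y
distance-lift-looped s r (inj₁ zero) = refl
distance-lift-looped s r (inj₂ _)    = refl

value-input : ∀ bs → value bs (inj₁ zero) ≡ 1
value-input []                   = refl
value-input (halver _ ∷ r)       = refl
value-input (loopedHalver _ ∷ r) = refl

distance-input : ∀ bs → distance bs (inj₁ zero) ≡ depth bs
distance-input []                   = refl
distance-input (halver _ ∷ r)       = refl
distance-input (loopedHalver _ ∷ r) = refl

emitWeight-input≤1 : ∀ bs → emitWeight bs (inj₁ zero) ≤ 1
emitWeight-input≤1 []                   = ≤-refl
emitWeight-input≤1 (halver _ ∷ r)       = z≤n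
emitWeight-input≤1 (loopedHalver _ ∷ r) = z≤n

emitWeight-input-nonempty : ∀ st r → emitWeight (st ∷ r) (inj₁ zero) ≡ 0
emitWeight-input-nonempty (halver _)       r = refl
emitWeight-input-nonempty (loopedHalver _) r = refl

value-outEdge : ∀ bs → value bs (outEdge bs) ≡ period bs
value-outEdge []                   = refl
value-outEdge (halver s ∷ r)       =
  trans (value-lift (halver s) r (outEdge r)) (trans (cong (2 *_) (value-outEdge r)) (sym (period-halver s r)))
value-outEdge (loopedHalver s ∷ r) = refl

emitWeight-outEdge : ∀ bs → emitWeight bs (outEdge bs) ≡ 1
emitWeight-outEdge []                   = refl
emitWeight-outEdge (halver s ∷ r)       = trans (emitWeight-lift (halver s) r (outEdge r)) (emitWeight-outEdge r)
emitWeight-outEdge (loopedHalver s ∷ r) = refl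

distance-outEdge : ∀ bs → distance bs (outEdge bs) ≡ 0
distance-outEdge []                   = refl
distance-outEdge (halver s ∷ r)       = trans (distance-lift-halver s r (outEdge r)) (distance-outEdge r)
distance-outEdge (loopedHalver s ∷ r) = refl

period-looped≤ : ∀ s r → period (loopedHalver s ∷ r) ≤ 2 * period r
period-looped≤ s r = ≤-trans (n≤1+n _) (≤-reflexive (sym (*-suc 2 (predPeriod r))))

double-*-≤ : ∀ {m n w v} → m ≤ 2 * n → n * w ≤ v → m * w ≤ 2 * v
double-*-≤ {m} {n} {w} m≤2n nw≤v =
  ≤-trans (*-monoˡ-≤ w m≤2n) (≤-trans (≤-reflexive (*-assoc 2 n w)) (*-monoʳ-≤ 2 nw≤v))

period*emitWeight≤value : ∀ bs y → period bs * emitWeight bs y ≤ value bs y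
period*emitWeight≤value []                   (inj₁ zero)                         = ≤-refl
period*emitWeight≤value (halver s ∷ r)       (inj₁ zero)                         =
  ≤-trans (≤-reflexive (*-zeroʳ (period (halver s ∷ r)))) z≤n
period*emitWeight≤value (halver s ∷ r)       (inj₂ (zero , zero))                =
  double-*-≤ (≤-reflexive (period-halver s r)) (period*emitWeight≤value r (inj₁ zero))
period*emitWeight≤value (halver s ∷ r)       (inj₂ (suc i , p))                  =
  double-*-≤ (≤-reflexive (period-halver s r)) (period*emitWeight≤value r (inj₂ (i , p)))
period*emitWeight≤value (loopedHalver s ∷ r) (inj₁ zero)                         =
  ≤-trans (≤-reflexive (*-zeroʳ (period (loopedHalver s ∷ r)))) z≤n
period*emitWeight≤value (loopedHalver s ∷ r) (inj₂ (zero , zero))                =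
  ≤-trans (≤-reflexive (*-zeroʳ (period (loopedHalver s ∷ r)))) z≤n
period*emitWeight≤value (loopedHalver s ∷ r) (inj₂ (suc zero , zero))            =
  double-*-≤ (period-looped≤ s r) (period*emitWeight≤value r (inj₁ zero))
period*emitWeight≤value (loopedHalver s ∷ r) (inj₂ (suc (suc zero) , zero))     =
  ≤-reflexive (*-identityʳ (period (loopedHalver s ∷ r)))
period*emitWeight≤value (loopedHalver s ∷ r) (inj₂ (suc (suc zero) , suc zero)) =
  ≤-trans (≤-reflexive (*-zeroʳ (period (loopedHalver s ∷ r)))) z≤n
period*emitWeight≤value (loopedHalver s ∷ r) (inj₂ (suc (suc (suc i)) , p))     =
  double-*-≤ (period-looped≤ s r) (period*emitWeight≤value r (inj₂ (i , p)))

emission : (bs : List Stage) → (Edge bs → ℕ) → (i : Fin (size bs))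
         → Fin (ins ⟦ gate bs i ⟧G) → Fin (states ⟦ gate bs i ⟧G) → ℕ
emission bs w i p q = sum (λ r → w (inj₂ (i , r)) * o ⟦ gate bs i ⟧G p q r)

next : (bs : List Stage) (i : Fin (size bs)) → Fin (ins ⟦ gate bs i ⟧G)
     → Fin (states ⟦ gate bs i ⟧G) → Fin (states ⟦ gate bs i ⟧G)
next bs i p q = t ⟦ gate bs i ⟧G p q

toppO≡toℕ : ∀ (q : Fin 2) → toppO q ≡ toℕ q
toppO≡toℕ zero       = refl
toppO≡toℕ (suc zero) = refl

toℕ≤1 : ∀ (q : Fin 2) → toℕ q ≤ 1
toℕ≤1 zero       = z≤n
toℕ≤1 (suc zero) = ≤-refl

toppler2-conserves : ∀ (q : Fin 2) → 1 + toℕ q ≡ 2 * toppO q + toℕ (toppT q)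
toppler2-conserves zero       = refl
toppler2-conserves (suc zero) = refl

toppler-value : ∀ r (q : Fin 2) → 1 + toℕ q ≡ (2 * value r (inj₁ zero) * toppO q + 0) + toℕ (toppT q)
toppler-value r q rewrite value-input r | +-identityʳ (2 * toppO q) = toppler2-conserves q

value-conserved : ∀ bs i p q → value bs (feeder bs i p) + stateValue bs i q
                             ≡ emission bs (value bs) i p q + stateValue bs i (next bs i p q)
value-conserved (halver s ∷ r)       zero                zero       q = toppler-value r q
value-conserved (halver s ∷ r)       (suc j)             p          q =
  trans (cong (_+ 2 * stateValue r j q) (value-lift (halver s) r (feeder r j p)))
        (scale-balance 2 (λ k → value r (inj₂ (j , k))) (o ⟦ gate r j ⟧G p q) {x = value r (feeder r j p)}
                       (value-conserved r j p q))
value-conserved (loopedHalver s ∷ r) zero                zero       q = refl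
value-conserved (loopedHalver s ∷ r) zero                (suc zero) q = refl
value-conserved (loopedHalver s ∷ r) (suc zero)          zero       q = toppler-value r q
value-conserved (loopedHalver s ∷ r) (suc (suc zero))    zero       q =
  trans (cong (_+ 0) (trans (value-lift (loopedHalver s) r (outEdge r)) (cong (2 *_) (value-outEdge r))))
        (splits (predPeriod r))
  where
  splits : ∀ k → 2 * suc k + 0 ≡ (suc (2 * k) * 1 + (1 * 1 + 0)) + 0
  splits = solve-∀
value-conserved (loopedHalver s ∷ r) (suc (suc (suc j))) p          q =
  trans (cong (_+ 2 * stateValue r j q) (value-lift (loopedHalver s) r (feeder r j p)))
        (scale-balance 2 (λ k → value r (inj₂ (j , k))) (o ⟦ gate r j ⟧G p q) {x = value r (feeder r j p)}
                       (value-conserved r j p q))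

toppler-emitWeight : ∀ w (q : Fin 2) → w * toppO q + 0 ≡ 0 + w * toℕ q
toppler-emitWeight w q = trans (+-identityʳ _) (cong (w *_) (toppO≡toℕ q))

emitWeight-gain : ∀ bs i p q → emission bs (emitWeight bs) i p q ≡ emitWeight bs (feeder bs i p) + emitGain bs i q
emitWeight-gain (halver s ∷ r)       zero                zero       q = toppler-emitWeight (emitWeight r (inj₁ zero)) q
emitWeight-gain (halver s ∷ r)       (suc j)             p          q =
  trans (emitWeight-gain r j p q) (cong (_+ emitGain r j q) (sym (emitWeight-lift (halver s) r (feeder r j p))))
emitWeight-gain (loopedHalver s ∷ r) zero                zero       q = refl
emitWeight-gain (loopedHalver s ∷ r) zero                (suc zero) q = refl
emitWeight-gain (loopedHalver s ∷ r) (suc zero)          zero       q = toppler-emitWeight (emitWeight r (inj₁ zero)) q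
emitWeight-gain (loopedHalver s ∷ r) (suc (suc zero))    zero       q =
  sym (cong (_+ 0) (trans (emitWeight-lift (loopedHalver s) r (outEdge r)) (emitWeight-outEdge r)))
emitWeight-gain (loopedHalver s ∷ r) (suc (suc (suc j))) p          q =
  trans (emitWeight-gain r j p q) (cong (_+ emitGain r j q) (sym (emitWeight-lift (loopedHalver s) r (feeder r j p))))

emitGain≤1 : ∀ bs i q → emitGain bs i q ≤ 1
emitGain≤1 (halver s ∷ r)       zero                q = *-mono-≤ (emitWeight-input≤1 r) (toℕ≤1 q)
emitGain≤1 (halver s ∷ r)       (suc i)             q = emitGain≤1 r i q
emitGain≤1 (loopedHalver s ∷ r) zero                q = z≤n
emitGain≤1 (loopedHalver s ∷ r) (suc zero)          q = *-mono-≤ (emitWeight-input≤1 r) (toℕ≤1 q)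
emitGain≤1 (loopedHalver s ∷ r) (suc (suc zero))    q = z≤n
emitGain≤1 (loopedHalver s ∷ r) (suc (suc (suc i))) q = emitGain≤1 r i q

emitGain-01 : ∀ bs i q → emitGain bs i q ≡ 0 ⊎ emitGain bs i q ≡ 1
emitGain-01 bs i q with emitGain bs i q | emitGain≤1 bs i q
... | zero        | _       = inj₁ refl
... | suc zero    | _       = inj₂ refl
... | suc (suc _) | s≤s ()

value≡2^length-lift : ∀ st r (y : Edge r) {σ} → value r y + σ ≡ 2 ^ length r × emitWeight r y ≡ 0
                    → value (st ∷ r) (lift st y) + 2 * σ ≡ 2 ^ length (st ∷ r) × emitWeight (st ∷ r) (lift st y) ≡ 0
value≡2^length-lift st r y {σ} (full , unweighted) =
  trans (cong (_+ 2 * σ) (value-lift st r y)) (trans (sym (*-distribˡ-+ 2 (value r y) σ)) (cong (2 *_) full)) ,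
  trans (emitWeight-lift st r y) unweighted

emitGain≡1⇒value≡2^length : ∀ bs i p q → emitGain bs i q ≡ 1
  → value bs (feeder bs i p) + stateValue bs i q ≡ 2 ^ length bs × emitWeight bs (feeder bs i p) ≡ 0
emitGain≡1⇒value≡2^length (halver s ∷ [])                       zero                zero (suc zero) _  = refl , refl
emitGain≡1⇒value≡2^length (halver s ∷ [])                       zero                zero zero       ()
emitGain≡1⇒value≡2^length (halver s ∷ halver _ ∷ _)             zero                zero q          ()
emitGain≡1⇒value≡2^length (halver s ∷ loopedHalver _ ∷ _)       zero                zero q          ()
emitGain≡1⇒value≡2^length (halver s ∷ r)                        (suc j)             p    q          gain≡1 =
  value≡2^length-lift (halver s) r (feeder r j p) (emitGain≡1⇒value≡2^length r j p q gain≡1)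
emitGain≡1⇒value≡2^length (loopedHalver s ∷ r)                  zero                _    q          ()
emitGain≡1⇒value≡2^length (loopedHalver s ∷ [])                 (suc zero)          zero (suc zero) _  = refl , refl
emitGain≡1⇒value≡2^length (loopedHalver s ∷ [])                 (suc zero)          zero zero       ()
emitGain≡1⇒value≡2^length (loopedHalver s ∷ halver _ ∷ _)       (suc zero)          zero q          ()
emitGain≡1⇒value≡2^length (loopedHalver s ∷ loopedHalver _ ∷ _) (suc zero)          zero q          ()
emitGain≡1⇒value≡2^length (loopedHalver s ∷ r)                  (suc (suc zero))    zero q          ()
emitGain≡1⇒value≡2^length (loopedHalver s ∷ r)                  (suc (suc (suc j))) p    q          gain≡1 =
  value≡2^length-lift (loopedHalver s) r (feeder r j p) (emitGain≡1⇒value≡2^length r j p q gain≡1)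

toppler-distance : ∀ d x (q : Fin 2) → suc (d * toppO q + 0) ≤ suc d + x
toppler-distance d x zero       rewrite *-zeroʳ d    = s≤s z≤n
toppler-distance d x (suc zero) rewrite *-identityʳ d = s≤s (+-monoʳ-≤ d z≤n)

looped-toppler-distance : ∀ d k D w (q : Fin 2)
                        → suc ((d + k * w) * toppO q + 0) ≤ suc d + suc (D + k) * (w * toℕ q)
looped-toppler-distance d k D w zero rewrite *-zeroʳ (d + k * w) = s≤s z≤n
looped-toppler-distance d k D w (suc zero)
  rewrite *-identityʳ (d + k * w) | *-identityʳ w | +-identityʳ (d + k * w) =
  s≤s (+-monoʳ-≤ d (*-monoˡ-≤ w (≤-trans (m≤n+m k D) (n≤1+n (D + k)))))

adder-distance : ∀ d D → suc (suc d * 1 + 0) ≡ (2 + d) + suc D * 0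
adder-distance = solve-∀

looped-lift-distance : ∀ d D k {e e' w g} → suc e ≤ d + suc D * g → e' ≡ w + g
                     → suc (e + k * e') ≤ (d + k * w) + suc (D + k) * g
looped-lift-distance d D k {e} {e'} {w} {g} decreases refl = begin
  suc e + k * (w + g)             ≤⟨ +-monoˡ-≤ (k * (w + g)) decreases ⟩
  d + suc D * g + k * (w + g)     ≡⟨ regroup d D k w g ⟩
  d + k * w + suc (D + k) * g     ∎
  where
  open ≤-Reasoning
  regroup : ∀ d D k w g → (d + suc D * g) + k * (w + g) ≡ (d + k * w) + suc (D + k) * g
  regroup = solve-∀

distance-decreases : ∀ bs i p q → suc (emission bs (distance bs) i p q)
                                  ≤ distance bs (feeder bs i p) + suc (loopDelay bs) * emitGain bs i q
distance-decreases (halver s ∷ r)       zero                zero       q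
  rewrite distance-input r = toppler-distance (depth r) _ q
distance-decreases (halver s ∷ r)       (suc j)             p          q
  rewrite distance-lift-halver s r (feeder r j p) = distance-decreases r j p q
distance-decreases (loopedHalver s ∷ r) zero                zero       q =
  ≤-reflexive (adder-distance (depth r) (loopDelay (loopedHalver s ∷ r)))
distance-decreases (loopedHalver s ∷ r) zero                (suc zero) q =
  ≤-reflexive (adder-distance (depth r) (loopDelay (loopedHalver s ∷ r)))
distance-decreases (loopedHalver s ∷ r) (suc zero)          zero       q
  rewrite distance-input r = looped-toppler-distance (depth r) (3 + depth r) (loopDelay r) (emitWeight r (inj₁ zero)) q
distance-decreases (loopedHalver s ∷ r) (suc (suc zero))    zero       q
  rewrite distance-lift-looped s r (outEdge r) | distance-outEdge r | emitWeight-outEdge r =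
  ≤-reflexive (splitter-distance (depth r) (loopDelay r))
  where
  splitter-distance : ∀ d D → suc (0 * 1 + ((2 + d) * 1 + 0)) ≡ (0 + (3 + d) * 1) + suc (D + (3 + d)) * 0
  splitter-distance = solve-∀
distance-decreases (loopedHalver s ∷ r) (suc (suc (suc j))) p          q
  rewrite sum-linear (3 + depth r) (λ k → distance r (inj₂ (j , k))) (λ k → emitWeight r (inj₂ (j , k)))
                     (o ⟦ gate r j ⟧G p q)
        | distance-lift-looped s r (feeder r j p) =
  looped-lift-distance (distance r (feeder r j p)) (loopDelay r) (3 + depth r)
                       (distance-decreases r j p q) (emitWeight-gain r j p q)

StateVector : List Stage → Set
StateVector bs = (i : Fin (size bs)) → Fin (states ⟦ gate bs i ⟧G)

totalStateValue : (bs : List Stage) → StateVector bs → ℕ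
totalStateValue bs σ = sum (λ i → stateValue bs i (σ i))

digit+double-< : ∀ {b x n} → b ≤ 1 → x < n → b + 2 * x < 2 * n
digit+double-< {b} {x} b≤1 x<n =
  ≤-trans (s≤s (+-monoˡ-≤ (2 * x) b≤1)) (≤-trans (≤-reflexive (sym (*-suc 2 x))) (*-monoʳ-≤ 2 x<n))

totalStateValue-< : ∀ bs σ → totalStateValue bs σ < 2 ^ length bs
totalStateValue-< []                   σ = s≤s z≤n
totalStateValue-< (halver s ∷ r)       σ
  rewrite sym (*-distribˡ-sum 2 (λ i → stateValue r i (σ (suc i)))) =
  digit+double-< (toℕ≤1 (σ zero)) (totalStateValue-< r (λ i → σ (suc i)))
totalStateValue-< (loopedHalver s ∷ r) σ
  rewrite sym (*-distribˡ-sum 2 (λ i → stateValue r i (σ (suc (suc (suc i)))))) =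
  digit+double-< (toℕ≤1 (σ (suc zero))) (totalStateValue-< r (λ i → σ (suc (suc (suc i)))))

totalStateValue-init : ∀ bs → totalStateValue bs (λ i → init ⟦ gate bs i ⟧G) ≡ initialValue bs
totalStateValue-init []                   = refl
totalStateValue-init (halver s ∷ r)       =
  cong (toℕ s +_) (trans (sym (*-distribˡ-sum 2 (λ i → stateValue r i (init ⟦ gate r i ⟧G))))
                         (cong (2 *_) (totalStateValue-init r)))
totalStateValue-init (loopedHalver s ∷ r) =
  cong (toℕ s +_) (trans (sym (*-distribˡ-sum 2 (λ i → stateValue r i (init ⟦ gate r i ⟧G))))
                         (cong (2 *_) (totalStateValue-init r)))

-- Runs of a chain

quotient-unique : ∀ {d} .{{_ : NonZero d}} {y t} → t < d → (y * d + t) / d ≡ y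
quotient-unique {d} {y} {t} t<d = begin
  (y * d + t) / d    ≡⟨ +-distrib-/-∣ˡ t (divides-refl y) ⟩
  y * d / d + t / d  ≡⟨ cong₂ _+_ (m*n/n≡m y d) (m<n⇒m/n≡0 t<d) ⟩
  y + 0              ≡⟨ +-identityʳ y ⟩
  y                  ∎
  where open ≡-Reasoning

module ChainRun (stage : Stage) (rest : List Stage) where
  bs : List Stage
  bs = stage ∷ rest

  open Dynamics (chain bs)
  open Potential (chain bs)

  input : S
  input = inj₁ zero

  -- The value not accounted for by pending input letters and by the innermost
  -- toppler's emissions; the subtraction never truncates (unheld≤value).
  heldWeight : S → ℕ
  heldWeight y = value bs y ∸ (δ input y + period bs * emitWeight bs y)

  Value Emitted Distance Held : Config → ℕ
  Value    = V (value bs) (stateValue bs)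
  Emitted  = load (emitWeight bs)
  Distance = load (distance bs)
  Held     = V heldWeight (stateValue bs)

  unheld≤value : ∀ y → δ input y + period bs * emitWeight bs y ≤ value bs y
  unheld≤value (inj₁ zero) rewrite emitWeight-input-nonempty stage rest | *-zeroʳ (period bs) | value-input bs = ≤-refl
  unheld≤value (inj₂ y)    = period*emitWeight≤value bs (inj₂ y)

  Value-split : ∀ c → Value c ≡ Held c + (cnt c input + period bs * Emitted c)
  Value-split c = begin
    load (value bs) c + Φ
      ≡⟨ cong (_+ Φ) (load-cong (λ y → sym (m∸n+n≡m (unheld≤value y))) c) ⟩
    load (λ y → heldWeight y + (δ input y + period bs * emitWeight bs y)) c + Φ
      ≡⟨ cong (_+ Φ) (load-+ heldWeight (λ y → δ input y + period bs * emitWeight bs y) c) ⟩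
    load heldWeight c + load (λ y → δ input y + period bs * emitWeight bs y) c + Φ
      ≡⟨ cong (λ m → load heldWeight c + m + Φ)
              (trans (load-+ (δ input) (λ y → period bs * emitWeight bs y) c)
                     (cong₂ _+_ (load-δ input c) (load-* (period bs) (emitWeight bs) c))) ⟩
    load heldWeight c + (cnt c input + period bs * Emitted c) + Φ
      ≡⟨ xy∙z≈xz∙y (load heldWeight c) _ Φ ⟩
    Held c + (cnt c input + period bs * Emitted c) ∎
    where
    open ≡-Reasoning
    Φ = stateSum (stateValue bs) c

  fired : ∀ {c c'} → Step c c' → S
  fired (fire s _ _ _ _ _ _ _) = s

  gain : ∀ {c c'} → Step c c' → ℕ
  gain {c} (fire _ i _ _ _ _ _ _) = emitGain bs i (st c i)

  gain-01 : ∀ {c c'} (step : Step c c') → gain step ≡ 0 ⊎ gain step ≡ 1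
  gain-01 {c} (fire _ i _ _ _ _ _ _) = emitGain-01 bs i (st c i)

  Value-step : ∀ {c c'} → Step c c' → Value c' ≡ Value c
  Value-step {c} {c'} (fire s i p feeds _ moved others balance) with feeder-unique bs s feeds
  ... | refl = +-cancelʳ-≡ _ (Value c') (Value c)
                 (trans (V-fire (value bs) (stateValue bs) s i p moved others balance)
                        (cong (Value c +_) (sym (value-conserved bs i p (st c i)))))

  Emitted-step : ∀ {c c'} (step : Step c c') → Emitted c' ≡ Emitted c + gain step
  Emitted-step {c} {c'} (fire s i p feeds _ _ _ balance) with feeder-unique bs s feeds
  ... | refl = +-cancelʳ-≡ (emitWeight bs s) (Emitted c') (Emitted c + emitGain bs i (st c i))
                 (trans (load-fire (emitWeight bs) {c} {c'} s i p balance)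
                        (trans (cong (Emitted c +_) (emitWeight-gain bs i p (st c i)))
                               (x∙yz≈xz∙y (Emitted c) (emitWeight bs s) _)))

  Distance-step : ∀ {c c'} (step : Step c c') → suc (Distance c') ≤ Distance c + suc (loopDelay bs) * gain step
  Distance-step {c} {c'} (fire s i p feeds _ _ _ balance) with feeder-unique bs s feeds
  ... | refl = +-cancelʳ-≤ (distance bs s) (suc (Distance c')) _ (begin
    suc (Distance c' + distance bs s)
      ≡⟨ cong suc (load-fire (distance bs) {c} {c'} s i p balance) ⟩
    suc (Distance c + emission bs (distance bs) i p (st c i))
      ≡⟨ +-suc (Distance c) _ ⟨
    Distance c + suc (emission bs (distance bs) i p (st c i))
      ≤⟨ +-monoʳ-≤ (Distance c) (distance-decreases bs i p (st c i)) ⟩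
    Distance c + (distance bs s + suc (loopDelay bs) * emitGain bs i (st c i))
      ≡⟨ x∙yz≈xz∙y (Distance c) (distance bs s) _ ⟩
    Distance c + suc (loopDelay bs) * emitGain bs i (st c i) + distance bs s ∎)
    where open ≤-Reasoning

  input-step : ∀ {c c'} (step : Step c c') → cnt c' input + δ (fired step) input ≡ cnt c input
  input-step (fire _ _ _ _ _ _ _ balance) = trans (balance input) (+-identityʳ _)

  Held-step : ∀ {c c'} (step : Step c c') → Held c' + cnt c' input + period bs * gain step ≡ Held c + cnt c input
  Held-step {c} {c'} step = +-cancelʳ-≡ (period bs * Emitted c) _ _ (begin
    Held c' + cnt c' input + period bs * gain step + period bs * Emitted c
      ≡⟨ regroup (Held c') (cnt c' input) (period bs) (gain step) (Emitted c) ⟩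
    Held c' + (cnt c' input + period bs * (Emitted c + gain step))
      ≡⟨ cong (λ e → Held c' + (cnt c' input + period bs * e)) (Emitted-step step) ⟨
    Held c' + (cnt c' input + period bs * Emitted c')
      ≡⟨ Value-split c' ⟨
    Value c'
      ≡⟨ Value-step step ⟩
    Value c
      ≡⟨ Value-split c ⟩
    Held c + (cnt c input + period bs * Emitted c)
      ≡⟨ +-assoc (Held c) _ _ ⟨
    Held c + cnt c input + period bs * Emitted c ∎)
    where
    open ≡-Reasoning
    regroup : ∀ h n p z e → h + n + p * z + p * e ≡ h + (n + p * (e + z))
    regroup = solve-∀

  value-unemitted : ∀ y → emitWeight bs y ≡ 0 → value bs y ≡ heldWeight y + δ input y
  value-unemitted y unemitted = begin
    value bs y                                                ≡⟨ m∸n+n≡m (unheld≤value y) ⟨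
    heldWeight y + (δ input y + period bs * emitWeight bs y)  ≡⟨ cong (λ m → heldWeight y + (δ input y + m)) period*0 ⟩
    heldWeight y + (δ input y + 0)                            ≡⟨ cong (heldWeight y +_) (+-identityʳ (δ input y)) ⟩
    heldWeight y + δ input y                                  ∎
    where
    open ≡-Reasoning
    period*0 = trans (cong (period bs *_) unemitted) (*-zeroʳ (period bs))

  Held-fired : ∀ {c c'} (step : Step c c') → gain step ≡ 1 → offset bs ≤ Held c'
  Held-fired {c} {c'} (fire s i p feeds nonempty moved others balance) gain≡1 with feeder-unique bs s feeds
  ... | refl = +-cancelʳ-≤ (period bs + cnt c' input) (offset bs) (Held c') (begin
    offset bs + (period bs + cnt c' input)
      ≡⟨ +-assoc (offset bs) _ _ ⟨
    offset bs + period bs + cnt c' input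
      ≡⟨ cong (_+ cnt c' input) (trans (offset+period bs) (sym full)) ⟩
    value bs s + stateValue bs i q + cnt c' input
      ≡⟨ cong (λ v → v + stateValue bs i q + cnt c' input) value≡held ⟩
    heldWeight s + δ input s + stateValue bs i q + cnt c' input
      ≡⟨ cong (λ d → heldWeight s + d + stateValue bs i q + cnt c' input) (δ-sym input s) ⟩
    heldWeight s + δ s input + stateValue bs i q + cnt c' input
      ≡⟨ regroup (heldWeight s) (δ s input) (stateValue bs i q) (cnt c' input) ⟩
    heldWeight s + stateValue bs i q + (cnt c' input + δ s input)
      ≤⟨ +-monoˡ-≤ _ (≤-V heldWeight (stateValue bs) c s i nonempty) ⟩
    Held c + (cnt c' input + δ s input)
      ≡⟨ cong (Held c +_) (input-step step) ⟩
    Held c + cnt c input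
      ≡⟨ Held-step step ⟨
    Held c' + cnt c' input + period bs * gain step
      ≡⟨ cong (λ z → Held c' + cnt c' input + period bs * z) gain≡1 ⟩
    Held c' + cnt c' input + period bs * 1
      ≡⟨ regroup' (Held c') (cnt c' input) (period bs) ⟩
    Held c' + (period bs + cnt c' input) ∎)
    where
    open ≤-Reasoning
    step = fire s i p feeds nonempty moved others balance
    q = st c i
    full = proj₁ (emitGain≡1⇒value≡2^length bs i p q gain≡1)
    value≡held = value-unemitted s (proj₂ (emitGain≡1⇒value≡2^length bs i p q gain≡1))
    regroup : ∀ h d v n → h + d + v + n ≡ h + v + (n + d)
    regroup = solve-∀
    regroup' : ∀ h n p → h + n + p * 1 ≡ h + (p + n)
    regroup' = solve-∀

  Held-unfired : ∀ {c c'} (step : Step c c') → gain step ≡ 0 → Held c ≤ Held c'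
  Held-unfired {c} {c'} step gain≡0 = +-cancelʳ-≤ (cnt c' input) (Held c) (Held c') (begin
    Held c + cnt c' input                           ≤⟨ +-monoʳ-≤ (Held c) (≤-trans (m≤m+n _ _) (≤-reflexive (input-step step))) ⟩
    Held c + cnt c input                            ≡⟨ Held-step step ⟨
    Held c' + cnt c' input + period bs * gain step  ≡⟨ cong (λ z → Held c' + cnt c' input + period bs * z) gain≡0 ⟩
    Held c' + cnt c' input + period bs * 0          ≡⟨ cong (Held c' + cnt c' input +_) (*-zeroʳ (period bs)) ⟩
    Held c' + cnt c' input + 0                      ≡⟨ +-identityʳ _ ⟩
    Held c' + cnt c' input                          ∎)
    where open ≤-Reasoning

  -- An emission of the innermost toppler may raise Distance by 1 + loopDelay, but
  -- it lowers Held + pending input by period ≥ 1.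
  measure : Config → ℕ
  measure c = suc (loopDelay bs) * (Held c + cnt c input) + Distance c

  measure-decreases : ∀ {c c'} → Step c c' → measure c' < measure c
  measure-decreases {c} {c'} step = begin-strict
    D * (Held c' + cnt c' input) + Distance c'
      <⟨ +-monoʳ-< (D * (Held c' + cnt c' input)) (Distance-step step) ⟩
    D * (Held c' + cnt c' input) + (Distance c + D * gain step)
      ≤⟨ +-monoʳ-≤ (D * (Held c' + cnt c' input)) (+-monoʳ-≤ (Distance c) (*-monoʳ-≤ D (m≤n*m _ (period bs)))) ⟩
    D * (Held c' + cnt c' input) + (Distance c + D * (period bs * gain step))
      ≡⟨ regroup D (Held c' + cnt c' input) (Distance c) (period bs * gain step) ⟩
    D * (Held c' + cnt c' input + period bs * gain step) + Distance c
      ≡⟨ cong (λ h → D * h + Distance c) (Held-step step) ⟩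
    measure c ∎
    where
    open ≤-Reasoning
    D = suc (loopDelay bs)
    regroup : ∀ d h x y → d * h + (x + d * y) ≡ d * (h + y) + x
    regroup = solve-∀

  -- offset ≤ Held is established by the first emission of the innermost toppler
  -- (emitGain≡1⇒value≡2^length) and preserved afterwards.
  Invariant : (Fin 1 → ℕ) → Config → Set
  Invariant x c = Value c ≡ x zero + initialValue bs × (Emitted c ≡ 0 ⊎ offset bs ≤ Held c)

  Invariant-initial : ∀ x → Invariant x (initial x)
  Invariant-initial x = cong₂ _+_ input-value (totalStateValue-init bs) , inj₁ input-unemitted
    where
    input-value : load (value bs) (initial x) ≡ x zero
    input-value = trans (load-initial (value bs) x)
                        (trans (cong (λ v → v * x zero + 0) (value-input bs)) (trans (+-identityʳ _) (*-identityˡ _)))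
    input-unemitted : Emitted (initial x) ≡ 0
    input-unemitted = trans (load-initial (emitWeight bs) x)
                            (cong (λ w → w * x zero + 0) (emitWeight-input-nonempty stage rest))

  Invariant-step : ∀ x {c c'} → Invariant x c → Step c c' → Invariant x c'
  Invariant-step x {c} {c'} (conserved , unemitted-or-held) step =
    trans (Value-step step) conserved , emitted-or-held (gain-01 step) unemitted-or-held
    where
    emitted-or-held : gain step ≡ 0 ⊎ gain step ≡ 1 → Emitted c ≡ 0 ⊎ offset bs ≤ Held c
                    → Emitted c' ≡ 0 ⊎ offset bs ≤ Held c'
    emitted-or-held (inj₂ gain≡1) _                = inj₂ (Held-fired step gain≡1)
    emitted-or-held (inj₁ gain≡0) (inj₁ unemitted) =
      inj₁ (trans (Emitted-step step) (cong₂ _+_ unemitted gain≡0))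
    emitted-or-held (inj₁ gain≡0) (inj₂ held)      = inj₂ (≤-trans held (Held-unfired step gain≡0))

  internal : ∀ y → y ≢ outEdge bs → Internal y
  internal y y≢out with wiring bs y in wired
  ... | inPort i p = i , p , refl
  ... | out zero   = ⊥-elim (y≢out (sym (outEdge-unique bs y wired)))
  ... | trash      = ⊥-elim (wiring≢trash bs y wired)

  heldWeight-outEdge : heldWeight (outEdge bs) ≡ 0
  heldWeight-outEdge rewrite value-outEdge bs | emitWeight-outEdge bs =
    m≤n⇒m∸n≡0 (≤-trans (≤-reflexive (sym (*-identityʳ (period bs)))) (m≤n+m _ (δ input (outEdge bs))))

  module _ (h : Config) (halted : Halted h) where
    load-halted-at-output : ∀ w → load w h ≡ w (outEdge bs) * output h zero
    load-halted-at-output w = load-halted w h (outEdge bs) halted internal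

    Value-halted : Value h ≡ period bs * output h zero + stateSum (stateValue bs) h
    Value-halted = cong (_+ stateSum (stateValue bs) h)
                        (trans (load-halted-at-output (value bs)) (cong (_* output h zero) (value-outEdge bs)))

    Emitted-halted : Emitted h ≡ output h zero
    Emitted-halted = trans (load-halted-at-output (emitWeight bs))
                           (trans (cong (_* output h zero) (emitWeight-outEdge bs)) (*-identityˡ (output h zero)))

    Held-halted : Held h ≡ stateSum (stateValue bs) h
    Held-halted = cong (_+ stateSum (stateValue bs) h)
                       (trans (load-halted-at-output heldWeight) (cong (_* output h zero) heldWeight-outEdge))

  halted-output : ∀ x h → Invariant x h → Halted h
                → output h zero ≡ (x zero + initialValue bs ∸ offset bs) / period bs
  halted-output x h (conserved , unemitted-or-held) halted = sym (begin
    (x zero + initialValue bs ∸ offset bs) / period bs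
      ≡⟨ cong (λ a → (a ∸ offset bs) / period bs) (trans (sym conserved) (Value-halted h halted)) ⟩
    (period bs * y + Φ ∸ offset bs) / period bs
      ≡⟨ cong (_/ period bs) (split unemitted-or-held) ⟩
    (y * period bs + (Φ ∸ offset bs)) / period bs
      ≡⟨ quotient-unique (m<n+o⇒m∸n<o Φ (offset bs) Φ<offset+period) ⟩
    y ∎)
    where
    open ≡-Reasoning
    y = output h zero
    Φ = stateSum (stateValue bs) h
    Φ<offset+period : Φ < offset bs + period bs
    Φ<offset+period = subst (Φ <_) (sym (offset+period bs)) (totalStateValue-< bs (st h))
    split : Emitted h ≡ 0 ⊎ offset bs ≤ Held h → period bs * y + Φ ∸ offset bs ≡ y * period bs + (Φ ∸ offset bs)
    split (inj₁ unemitted) rewrite trans (sym (Emitted-halted h halted)) unemitted | *-zeroʳ (period bs) = refl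
    split (inj₂ held)      = trans (+-∸-assoc (period bs * y) (≤-trans held (≤-reflexive (Held-halted h halted))))
                                   (cong (_+ (Φ ∸ offset bs)) (*-comm (period bs) y))

  chain-computes : Computes (λ x _ → (x zero + initialValue bs ∸ offset bs) / period bs)
  chain-computes x =
    halting-run measure (Invariant x) (λ inv step → Invariant-step x inv step , measure-decreases step)
                (initial x) (Invariant-initial x) ,
    λ { h run halted zero →
          halted-output x h (Star-preserves (Invariant x) (Invariant-step x) (Invariant-initial x) run) halted }

-- Topplers and delayers

halve : ∀ n → ∃ λ (b : Fin 2) → ∃ λ h → n ≡ toℕ b + 2 * h
halve zero = zero , 0 , refl
halve (suc n) with halve n
... | zero     , h , refl = suc zero , h , refl
... | suc zero , h , refl = zero , suc h , sym (*-suc 2 h)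

halve-≤ : ∀ b {q h} → b + 2 * q ≤ suc (2 * h) → q ≤ h
halve-≤ b {q} {h} bound =
  ≤-pred (*-cancelˡ-< 2 q (suc h) (≤-trans (s≤s (≤-trans (m≤n+m (2 * q) b) bound)) (≤-reflexive (sym (*-suc 2 h)))))

-- Binary expansion of the period: an odd predPeriod 2h + 1 starts the chain
-- with a halver around period h + 1, an even one 2h with a looped halver
-- around period h + 1.
stages-for : ∀ l q → q ≤ l → ∃ λ bs → predPeriod bs ≡ l × initialValue bs ≡ q + offset bs
stages-for l = go l (<-wellFounded l)
  where
  open ≡-Reasoning
  carry : ∀ b q m → b + 2 * (q + m) ≡ (b + 2 * q) + 2 * m
  carry = solve-∀
  go : ∀ l → Acc _<_ l → ∀ q → q ≤ l → ∃ λ bs → predPeriod bs ≡ l × initialValue bs ≡ q + offset bs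
  go l (acc smaller) q q≤l with halve l
  ... | zero , zero , refl with z≤n ← q≤l = [] , refl , refl
  ... | suc zero , h , refl with halve q
  ...   | b , q' , refl with go h (smaller (s≤s (m≤m+n h (h + 0)))) q' (halve-≤ (toℕ b) q≤l)
  ...     | r , period-r , initial-r =
    halver b ∷ r , cong (λ k → suc (2 * k)) period-r ,
    trans (cong (λ v → toℕ b + 2 * v) initial-r) (carry (toℕ b) q' (offset r))
  go l (acc smaller) q q≤l | zero , suc h , refl with halve (suc q)
  ...   | b , q' , q+1≡ with go (suc h) (smaller (m<m+n (suc h) (s≤s z≤n))) q'
                              (halve-≤ (toℕ b) (subst (_≤ suc (2 * suc h)) q+1≡ (s≤s q≤l)))
  ...     | r , period-r , initial-r = loopedHalver b ∷ r , cong (2 *_) period-r , (begin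
    toℕ b + 2 * initialValue r       ≡⟨ cong (λ v → toℕ b + 2 * v) initial-r ⟩
    toℕ b + 2 * (q' + offset r)      ≡⟨ carry (toℕ b) q' (offset r) ⟩
    toℕ b + 2 * q' + 2 * offset r    ≡⟨ cong (_+ 2 * offset r) q+1≡ ⟨
    suc q + 2 * offset r             ≡⟨ +-suc q (2 * offset r) ⟨
    q + suc (2 * offset r)           ∎)

toppler-run : ∀ l (q₀ q : Fin (suc l)) k → runWord (toppler (suc l) q₀) q (replicate k zero) zero ≡ (k + toℕ q) / suc l
toppler-run l q₀ q zero    = sym (m<n⇒m/n≡0 (toℕ<n q))
toppler-run l q₀ q (suc k) with suc (toℕ q) <? suc l
... | yes q+1<l = trans (toppler-run l q₀ (fromℕ< q+1<l) k)
                        (cong (_/ suc l) (trans (cong (k +_) (toℕ-fromℕ< q+1<l)) (+-suc k (toℕ q))))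
... | no q+1≮l  = trans (cong suc (trans (toppler-run l q₀ zero k) (cong (_/ suc l) (+-identityʳ k)))) (sym wraps)
  where
  q≡l : toℕ q ≡ l
  q≡l = ≤-antisym (≤-pred (toℕ<n q)) (≤-pred (≮⇒≥ q+1≮l))
  wraps : (suc k + toℕ q) / suc l ≡ suc (k / suc l)
  wraps = begin
    (suc k + toℕ q) / suc l  ≡⟨ cong (λ v → (suc k + v) / suc l) q≡l ⟩
    (suc k + l) / suc l      ≡⟨ cong (_/ suc l) (sym (+-suc k l)) ⟩
    (k + suc l) / suc l      ≡⟨ m/n≡1+[m∸n]/n (m≤n+m (suc l) k) ⟩
    suc ((k + suc l ∸ suc l) / suc l) ≡⟨ cong (λ v → suc (v / suc l)) (m+n∸n≡m k (suc l)) ⟩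
    suc (k / suc l) ∎
    where open ≡-Reasoning

toppler-function : ∀ l (q : Fin (suc l)) x → procFun (toppler (suc l) q) x zero ≡ (x zero + toℕ q) / suc l
toppler-function l q x =
  trans (cong (λ w → runWord (toppler (suc l) q) q w zero) (++-identityʳ (replicate (x zero) zero)))
        (toppler-run l q q (x zero))

delayer-function : ∀ x → procFun delayer x zero ≡ x zero ∸ 1
delayer-function x =
  trans (cong (λ w → runWord delayer zero w zero) (++-identityʳ (replicate (x zero) zero))) (delayed (x zero))
  where
  passing : ∀ k → runWord delayer (suc zero) (replicate k zero) zero ≡ k
  passing zero    = refl
  passing (suc k) = cong suc (passing k)
  delayed : ∀ k → runWord delayer zero (replicate k zero) zero ≡ k ∸ 1
  delayed zero    = refl
  delayed (suc k) = passing k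

toppler-emulated : (l : ℕ) → 3 ≤ l → (q : Fin l) → Σ (Network Gate ⟦_⟧G 1 1) (λ N → Emulates (toppler l q) N)
toppler-emulated (suc l) (s≤s (s≤s (s≤s _))) q with stages-for l (toℕ q) (≤-pred (toℕ<n q))
... | stage ∷ rest , period-bs , initial-bs =
  chain bs , Computes-cong (chain bs) agree chain-computes
  where
  open ChainRun stage rest using (bs; chain-computes)
  open ≡-Reasoning
  agree : ∀ x e → (x zero + initialValue bs ∸ offset bs) / period bs ≡ procFun (toppler (suc l) q) x e
  agree x zero = begin
    (x zero + initialValue bs ∸ offset bs) / period bs
      ≡⟨ cong (λ v → (x zero + v ∸ offset bs) / period bs) initial-bs ⟩
    (x zero + (toℕ q + offset bs) ∸ offset bs) / period bs
      ≡⟨ cong (λ v → (v ∸ offset bs) / period bs) (+-assoc (x zero) (toℕ q) _) ⟨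
    (x zero + toℕ q + offset bs ∸ offset bs) / period bs
      ≡⟨ cong (_/ period bs) (m+n∸n≡m (x zero + toℕ q) (offset bs)) ⟩
    (x zero + toℕ q) / period bs
      ≡⟨ /-congʳ {m = x zero + toℕ q} (cong suc period-bs) ⟩
    (x zero + toℕ q) / suc l
      ≡⟨ toppler-function l q x ⟨
    procFun (toppler (suc l) q) x zero ∎

delayer-emulated : Σ (Network Gate ⟦_⟧G 1 1) (λ N → Emulates delayer N)
delayer-emulated = chain (loopedHalver zero ∷ []) ,
  Computes-cong (chain (loopedHalver zero ∷ [])) agree (ChainRun.chain-computes (loopedHalver zero) [])
  where
  agree : ∀ x e → (x zero + 0 ∸ 1) / 1 ≡ procFun delayer x e
  agree x zero = begin
    (x zero + 0 ∸ 1) / 1    ≡⟨ n/1≡n _ ⟩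
    x zero + 0 ∸ 1          ≡⟨ cong (_∸ 1) (+-identityʳ (x zero)) ⟩
    x zero ∸ 1              ≡⟨ delayer-function x ⟨
    procFun delayer x zero  ∎
    where open ≡-Reasoning

proposition1p4 : ((l : ℕ) → 3 ≤ l → (q : Fin l)
                   → Σ (Network Gate ⟦_⟧G 1 1) (λ N → Emulates (toppler l q) N))
                 × Σ (Network Gate ⟦_⟧G 1 1) (λ N → Emulates delayer N)
proposition1p4 = toppler-emulated , delayer-emulated
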